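{- Let $d$ be a positive integer, let $f\colon\mathbb{N}^d\to\mathbb{N}$ be a $d$-tupling function, and let $s\colon\mathbb{N}^d\to\mathbb{N}$ be a function such that $U_s^{<k}$ is finite for every $k\in\mathbb{N}$. Then $s$ is a shell numbering for $f$ if and only if $f(\mathbf{x})<\bigl|U_s^{<s(\mathbf{x})+1}\bigr|$ for all $\mathbf{x}\in\mathbb{N}^d$.
   Context: $\mathbb{N}$ denotes the non-negative integers. A $d$-tupling function is a bijection $\mathbb{N}^d\to\mathbb{N}$. For $s\colon\mathbb{N}^d\to\mathbb{N}$ and $k\in\mathbb{N}$, $U_s^{<k}=\{\mathbf{y}\in\mathbb{N}^d : s(\mathbf{y})<k\}$. A function $s\colon\mathbb{N}^d\to\mathbb{N}$ is a shell numbering for $f$ if for all $\mathbf{x},\mathbf{y}\in\mathbb{N}^d$, $s(\mathbf{x})<s(\mathbf{y})$ implies $f(\mathbf{x})<f(\mathbf{y})$. -}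

module Defs where

open import Level using (0ℓ)
open import Data.Nat using (ℕ; _<_)
open import Data.Fin using (Fin)
open import Data.Vec using (Vec)
open import Data.Product using (Σ; ∃; proj₁)
open import Relation.Binary.PropositionalEquality using (_≡_)
open import Function.Definitions using (Bijective)
open import Function.Bundles using (_↔_)

IsTupling : (d : ℕ) → (Vec ℕ d → ℕ) → Set
IsTupling d f = Bijective _≡_ _≡_ f

U< : {d : ℕ} → (Vec ℕ d → ℕ) → ℕ → Set
U< {d} s k = Σ (Vec ℕ d) (λ y → s y < k)

HasCard : Set → ℕ → Set
HasCard A n = A ↔ Fin n

Finite : Set → Set
Finite A = ∃ (HasCard A)

card : {A : Set} → Finite A → ℕ
card = proj₁

IsShellNumbering : {d : ℕ} → (Vec ℕ d → ℕ) → (Vec ℕ d → ℕ) → Set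
IsShellNumbering {d} s f = (x y : Vec ℕ d) → s x < s y → f x < f y

module Submission where

-- Both directions are pigeonhole arguments about the finite sets U<k.
-- (⇒) A shell numbering never lets f decrease against s, so every preimage
--     f⁻¹(v) with v ≤ f x lies in U<(s x + 1); these f x + 1 distinct
--     points inject into U<(s x + 1).
-- (⇐) If s x < s y but f y ≤ f x, then f maps the |U<(s x + 1)| points of
--     U<(s x + 1) together with the extra point y injectively into the
--     numbers below |U<(s x + 1)| (using that |U<k| is monotone in k),
--     which is impossible.

open import Defs
open import Data.Nat using (ℕ; suc; _<_; _≤_; s≤s; s≤s⁻¹)
open import Data.Nat.Properties
  using (<-irrelevant; <⇒≱; ≮⇒≥; ≤-<-trans; <-≤-trans; ≤-reflexive; ≤-trans; n≮n; ≰⇒>)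
open import Data.Vec using (Vec)
open import Data.Fin using (Fin; zero; suc; toℕ)
open import Data.Fin.Properties using (injective⇒≤; toℕ-injective; toℕ<n; fromℕ<-injective)
open import Data.Product using (_,_; proj₁; proj₂)
open import Data.Empty using (⊥-elim)
open import Relation.Binary.PropositionalEquality using (_≡_; _≢_; refl; sym; trans; cong)
open import Function.Definitions using (Injective)
open import Function.Bundles using (_⇔_; mk⇔; Inverse; Injection)
open import Function.Properties.Inverse using (Inverse⇒Injection; ↔-sym)

injection-into-card⇒≤ : {A : Set} {m n : ℕ} → HasCard A n →
  (h : Fin m → A) → Injective _≡_ _≡_ h → m ≤ n
injection-into-card⇒≤ e h h-inj =
  injective⇒≤ (λ eq → h-inj (Injection.injective (Inverse⇒Injection e) eq))

bounded-injection⇒≤ : {m n : ℕ} (h : Fin m → ℕ) → (∀ i → h i < n) →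
  Injective _≡_ _≡_ h → m ≤ n
bounded-injection⇒≤ h h<n h-inj =
  injective⇒≤ (λ {i} {j} eq → h-inj (fromℕ<-injective (h i) (h j) (h<n i) (h<n j) eq))

module Sublevels {d : ℕ} (s : Vec ℕ d → ℕ) (fin : (k : ℕ) → Finite (U< s k)) where

  U<-≡ : {k : ℕ} {u v : U< s k} → proj₁ u ≡ proj₁ v → u ≡ v
  U<-≡ {u = y , p} {v = .y , q} refl = cong (y ,_) (<-irrelevant p q)

  N : ℕ → ℕ
  N k = card (fin k)

  enum : (k : ℕ) → Fin (N k) → U< s k
  enum k = Inverse.from (proj₂ (fin k))

  enum-injective : (k : ℕ) → Injective _≡_ _≡_ (enum k)
  enum-injective k = Injection.injective (Inverse⇒Injection (↔-sym (proj₂ (fin k))))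

  point : (k : ℕ) → Fin (N k) → Vec ℕ d
  point k j = proj₁ (enum k j)

  point-below : (k : ℕ) (j : Fin (N k)) → s (point k j) < k
  point-below k j = proj₂ (enum k j)

  point-injective : (k : ℕ) → Injective _≡_ _≡_ (point k)
  point-injective k eq = enum-injective k (U<-≡ eq)

  N-mono : {a b : ℕ} → a ≤ b → N a ≤ N b
  N-mono {a} {b} a≤b = injection-into-card⇒≤ (proj₂ (fin b)) include include-injective
    where
    include : Fin (N a) → U< s b
    include j = point a j , <-≤-trans (point-below a j) a≤b
    include-injective : Injective _≡_ _≡_ include
    include-injective eq = point-injective a (cong proj₁ eq)

  point-≢-outside : {k : ℕ} {y : Vec ℕ d} → k ≤ s y → (j : Fin (N k)) → point k j ≢ y
  point-≢-outside {k} k≤sy j p≡y =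
    <⇒≱ (point-below k j) (≤-trans k≤sy (≤-reflexive (cong s (sym p≡y))))

module Directions {d : ℕ} (f : Vec ℕ d → ℕ) (f-bij : IsTupling d f)
                  (s : Vec ℕ d → ℕ) (fin : (k : ℕ) → Finite (U< s k)) where

  open Sublevels s fin

  f-injective : Injective _≡_ _≡_ f
  f-injective = proj₁ f-bij

  pre : ℕ → Vec ℕ d
  pre v = proj₁ (proj₂ f-bij v)

  f-pre : (v : ℕ) → f (pre v) ≡ v
  f-pre v = proj₂ (proj₂ f-bij v) refl

  shell-reflects-≤ : IsShellNumbering s f → (x z : Vec ℕ d) → f z ≤ f x → s z ≤ s x
  shell-reflects-≤ shell x z fz≤fx = ≮⇒≥ (λ sx<sz → <⇒≱ (shell x z sx<sz) fz≤fx)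

  -- (⇒) The preimages of 0, …, f x form f x + 1 distinct points of U<(s x + 1).
  shell⇒bound : IsShellNumbering s f → (x : Vec ℕ d) → f x < N (suc (s x))
  shell⇒bound shell x =
    injection-into-card⇒≤ (proj₂ (fin (suc (s x)))) preimage preimage-injective
    where
    preimage : Fin (suc (f x)) → U< s (suc (s x))
    preimage i = pre (toℕ i) , s≤s (shell-reflects-≤ shell x (pre (toℕ i))
      (≤-trans (≤-reflexive (f-pre (toℕ i))) (s≤s⁻¹ (toℕ<n i))))
    preimage-injective : Injective _≡_ _≡_ preimage
    preimage-injective {i} {j} eq = toℕ-injective
      (trans (sym (f-pre (toℕ i))) (trans (cong f (cong proj₁ eq)) (f-pre (toℕ j))))

  bound⇒f<N : ((x : Vec ℕ d) → f x < N (suc (s x))) →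
    (k : ℕ) (j : Fin (N k)) → f (point k j) < N k
  bound⇒f<N bound k j = <-≤-trans (bound (point k j)) (N-mono (point-below k j))

  extend : Vec ℕ d → (k : ℕ) → Fin (suc (N k)) → Vec ℕ d
  extend y k zero    = y
  extend y k (suc j) = point k j

  extend-injective : (y : Vec ℕ d) (k : ℕ) → k ≤ s y → Injective _≡_ _≡_ (extend y k)
  extend-injective y k k≤sy {zero}  {zero}  eq = refl
  extend-injective y k k≤sy {zero}  {suc j} eq = ⊥-elim (point-≢-outside k≤sy j (sym eq))
  extend-injective y k k≤sy {suc i} {zero}  eq = ⊥-elim (point-≢-outside k≤sy i eq)
  extend-injective y k k≤sy {suc i} {suc j} eq = cong suc (point-injective k eq)

  -- (⇐) If s x < s y but f y ≤ f x, then with k = s x + 1 the map f injects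
  -- the N k + 1 points of extend y k into the numbers below N k.
  bound⇒shell : ((x : Vec ℕ d) → f x < N (suc (s x))) → IsShellNumbering s f
  bound⇒shell bound x y sx<sy = ≰⇒> (λ fy≤fx → n≮n (N k)
    (bounded-injection⇒≤ (λ i → f (extend y k i)) (f-extend<N fy≤fx)
      (λ eq → extend-injective y k sx<sy (f-injective eq))))
    where
    k : ℕ
    k = suc (s x)
    f-extend<N : f y ≤ f x → (i : Fin (suc (N k))) → f (extend y k i) < N k
    f-extend<N fy≤fx zero    = ≤-<-trans fy≤fx (bound x)
    f-extend<N fy≤fx (suc j) = bound⇒f<N bound k j

corollary2p4 : (d : ℕ) → 1 ≤ d →
    (f : Vec ℕ d → ℕ) → IsTupling d f →
    (s : Vec ℕ d → ℕ) → (fin : (k : ℕ) → Finite (U< s k)) →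
    (IsShellNumbering s f ⇔ ((x : Vec ℕ d) → f x < card (fin (suc (s x)))))
corollary2p4 d _ f f-bij s fin = mk⇔ shell⇒bound bound⇒shell
  where open Directions f f-bij s fin
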